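{- Let $S, S'$ be spatial predicates, let $s$ be a stack with $s \models \mathrm{Collide}(S,S')$, and let $h$ be a heap with $s,h\models S'$. If there is a partition $h = h_1 \ast h_2$ with $s,h_1\models S$, then $s,h_2 \models \mathrm{Update}(S,S')$.
   Context: Setting: a many-sorted first-order language whose sorts include $\mathsf{Int}$ and $\mathsf{Bool}$, with equality $\simeq$, boolean connectives and possibly further theory symbols with standard interpretations. A stack is a function $s$ mapping variables to values of their sorts, extended to pure (spatial-symbol-free) expressions by the standard interpretation. A heap is a partial function $h\colon\mathbb{Z}\rightharpoonup\mathsf{Val}$. $h = h_1\ast h_2$ means $h$ is the union of $h_1,h_2$ and their domains are disjoint. Spatial predicates are $\mathrm{emp}$, $\mathrm{next}(x,y)$, $\mathrm{lseg}(x,y)$ with $x,y$ pure $\mathsf{Int}$ expressions. Semantics: $s,h\models\Pi$ for pure $\Pi$ iff $s(\Pi)=\top$; $s,h\models\mathrm{emp}$ iff $h=\emptyset$; $s,h\models\mathrm{next}(x,y)$ iff $h=\{s(x)\mapsto s(y)\}$; $s,h\models F_1\ast F_2$ iff $h=h_1\ast h_2$ with $s,h_1\models F_1$, $s,h_2\models F_2$; $s,h\models\mathrm{lseg}(x,z)$ iff there are $n\ge0$ and integers $a_0,\dots,a_n$ with $a_0=s(x)$, $a_n=s(z)$, $a_i\ne s(z)$ for $i<n$, and $h=\{a_0\mapsto a_1\}\ast\dots\ast\{a_{n-1}\mapsto a_n\}$ (the inductive definition $\mathrm{lseg}(x,z)\equiv(x\simeq z\land\mathrm{emp})\lor(x\not\simeq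 z\land\exists y.\,\mathrm{next}(x,y)\ast\mathrm{lseg}(y,z))$). For a pure formula $F$, $s\models F$ means $s(F)=\top$. Definitions: $\mathrm{Empty}(\mathrm{emp})=\top$, $\mathrm{Empty}(\mathrm{next}(x,y))=\bot$, $\mathrm{Empty}(\mathrm{lseg}(x,y))=(x\simeq y)$; $\mathrm{Addr}(\mathrm{next}(x,y))=\mathrm{Addr}(\mathrm{lseg}(x,y))=x$. $\mathrm{Collide}(S,S')=\lnot\mathrm{Empty}(S)\land\lnot\mathrm{Empty}(S')\land\mathrm{Addr}(S)\simeq\mathrm{Addr}(S')$ (so neither $S$ nor $S'$ is $\mathrm{emp}$ when it holds). $\mathrm{Update}(S,S')$ is defined for $S\in\{\mathrm{next}(x,y),\mathrm{lseg}(x,y)\}$ and $S'\in\{\mathrm{next}(x',z),\mathrm{lseg}(x',z)\}$ by: $\mathrm{Update}(\mathrm{next}(x,y),\mathrm{next}(x',z))=\mathrm{emp}$; $\mathrm{Update}(\mathrm{next}(x,y),\mathrm{lseg}(x',z))=\mathrm{lseg}(y,z)$; $\mathrm{Update}(\mathrm{lseg}(x,y),\mathrm{next}(x',z))=\mathrm{emp}$; $\mathrm{Update}(\mathrm{lseg}(x,y),\mathrm{lseg}(x',z))=\mathrm{lseg}(y,z)$. -}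

module Defs where

open import Data.Integer using (ℤ)
open import Data.Maybe using (Maybe; just; nothing)
open import Data.List using (List; []; _∷_)
open import Data.Product using (Σ; ∃; _×_; _,_)
open import Data.Sum using (_⊎_)
open import Data.Unit using (⊤)
open import Data.Empty using (⊥)
open import Relation.Nullary using (¬_)
open import Relation.Binary.PropositionalEquality using (_≡_; _≢_)

-- Heaps: partial functions ℤ ⇀ Val, with Val = ℤ (list cells store addresses).
Heap : Set
Heap = ℤ → Maybe ℤ

_≐_∗_ : Heap → Heap → Heap → Set
h ≐ h₁ ∗ h₂ = ∀ a → (h a ≡ h₁ a × h₂ a ≡ nothing) ⊎ (h a ≡ h₂ a × h₁ a ≡ nothing)

IsEmpty : Heap → Set
IsEmpty h = ∀ a → h a ≡ nothing

IsSingleton : Heap → ℤ → ℤ → Set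
IsSingleton h a b = ∀ a' → (a' ≡ a → h a' ≡ just b) × (a' ≢ a → h a' ≡ nothing)

Chain : Heap → List ℤ → Set
Chain h [] = ⊥
Chain h (a ∷ []) = IsEmpty h
Chain h (a ∷ b ∷ rest) =
  Σ Heap λ h₁ → Σ Heap λ h₂ → h ≐ h₁ ∗ h₂ × IsSingleton h₁ a b × Chain h₂ (b ∷ rest)

data Head : List ℤ → ℤ → Set where
  head : ∀ {a as} → Head (a ∷ as) a

data Last : List ℤ → ℤ → Set where
  last-[] : ∀ {a} → Last (a ∷ []) a
  last-∷  : ∀ {a b as z} → Last (b ∷ as) z → Last (a ∷ b ∷ as) z

InitAvoid : List ℤ → ℤ → Set
InitAvoid [] z = ⊤
InitAvoid (a ∷ []) z = ⊤
InitAvoid (a ∷ b ∷ as) z = (a ≢ z) × InitAvoid (b ∷ as) z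

module SL {Stack : Set} (Expr : Set) (⟦_⟧ : Expr → Stack → ℤ) where

  -- pure formulas (the fragment needed for Empty / Collide)
  data Pure : Set where
    ⊤ᵖ ⊥ᵖ : Pure
    _≃_  : Expr → Expr → Pure
    ¬ᵖ_  : Pure → Pure
    _∧ᵖ_ : Pure → Pure → Pure

  _⊨ᵖ_ : Stack → Pure → Set
  s ⊨ᵖ ⊤ᵖ = ⊤
  s ⊨ᵖ ⊥ᵖ = ⊥
  s ⊨ᵖ (x ≃ y) = ⟦ x ⟧ s ≡ ⟦ y ⟧ s
  s ⊨ᵖ (¬ᵖ F) = ¬ (s ⊨ᵖ F)
  s ⊨ᵖ (F ∧ᵖ G) = (s ⊨ᵖ F) × (s ⊨ᵖ G)

  data Spatial : Set where
    emp  : Spatial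
    next : Expr → Expr → Spatial
    lseg : Expr → Expr → Spatial

  _,_⊨_ : Stack → Heap → Spatial → Set
  s , h ⊨ emp = IsEmpty h
  s , h ⊨ next x y = IsSingleton h (⟦ x ⟧ s) (⟦ y ⟧ s)
  s , h ⊨ lseg x z = Σ (List ℤ) λ as →
    Head as (⟦ x ⟧ s) × Last as (⟦ z ⟧ s) × InitAvoid as (⟦ z ⟧ s) × Chain h as

  Empty : Spatial → Pure
  Empty emp = ⊤ᵖ
  Empty (next x y) = ⊥ᵖ
  Empty (lseg x y) = x ≃ y

  -- Addr is only defined on next / lseg
  Collide : Spatial → Spatial → Pure
  Collide emp S' = ⊥ᵖ
  Collide S emp = ⊥ᵖ
  Collide S@(next x _) S'@(next x' _) = (¬ᵖ Empty S) ∧ᵖ ((¬ᵖ Empty S') ∧ᵖ (x ≃ x'))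
  Collide S@(next x _) S'@(lseg x' _) = (¬ᵖ Empty S) ∧ᵖ ((¬ᵖ Empty S') ∧ᵖ (x ≃ x'))
  Collide S@(lseg x _) S'@(next x' _) = (¬ᵖ Empty S) ∧ᵖ ((¬ᵖ Empty S') ∧ᵖ (x ≃ x'))
  Collide S@(lseg x _) S'@(lseg x' _) = (¬ᵖ Empty S) ∧ᵖ ((¬ᵖ Empty S') ∧ᵖ (x ≃ x'))

  Update : Spatial → Spatial → Maybe Spatial
  Update (next x y) (next x' z) = just emp
  Update (next x y) (lseg x' z) = just (lseg y z)
  Update (lseg x y) (next x' z) = just emp
  Update (lseg x y) (lseg x' z) = just (lseg y z)
  Update _ _ = nothing

-- A separated subheap h₁ of h is determined by its contents: every cell of h₁
-- is a cell of h, and heaps are functional, so a chain of h₁ starting at the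
-- address where the list segment h starts must follow the cells of h. Hence
-- h₁ is a prefix of the segment and the remainder h₂ is the corresponding
-- suffix, a segment from where h₁ stops to the end of h. If instead h is a
-- single cell, h₁ occupies it and nothing is left for h₂.
module Submission where

open import Defs
open import Data.Integer using (ℤ; _≟_)
open import Data.Maybe using (just; nothing)
open import Data.Maybe.Properties using (just-injective)
open import Data.List using (List; []; _∷_)
open import Data.Product using (Σ; ∃; _×_; _,_; proj₁; proj₂)
open import Data.Sum using (inj₁; inj₂)
open import Data.Empty using (⊥-elim)
open import Relation.Nullary using (yes; no)
open import Relation.Binary.PropositionalEquality
  using (_≡_; _≢_; _≗_; refl; sym; trans; subst)

private
  variable
    h h' h₁ h₂ e e' k g : Heap
    a b b' c v y z : ℤ
    l : List ℤ

  just≢nothing : just v ≢ nothing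
  just≢nothing ()

∗-definedˡ : h ≐ h₁ ∗ h₂ → h₁ c ≡ just v → h c ≡ just v
∗-definedˡ {c = c} sp eq with sp c
... | inj₁ (p , _) = trans p eq
... | inj₂ (_ , q) = ⊥-elim (just≢nothing (trans (sym eq) q))

∗-disjoint : h ≐ h₁ ∗ h₂ → h₁ c ≡ just v → h₂ c ≡ nothing
∗-disjoint {c = c} sp eq with sp c
... | inj₁ (_ , q) = q
... | inj₂ (_ , q) = ⊥-elim (just≢nothing (trans (sym eq) q))

∗-undefinedˡ : h ≐ h₁ ∗ h₂ → h₁ c ≡ nothing → h c ≡ h₂ c
∗-undefinedˡ {c = c} sp eq with sp c
... | inj₁ (p , q) = trans p (trans eq (sym q))
... | inj₂ (p , _) = p

∗-identityˡ : IsEmpty h₁ → h ≐ h₁ ∗ h₂ → h ≗ h₂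
∗-identityˡ empty sp c = ∗-undefinedˡ sp (empty c)

singleton-at : IsSingleton h a b → h a ≡ just b
singleton-at {a = a} sg = proj₁ (sg a) refl

singleton-outside : IsSingleton h a b → c ≢ a → h c ≡ nothing
singleton-outside {c = c} sg = proj₂ (sg c)

∗-cancel-singletonˡ : IsSingleton e a b → IsSingleton e' a b' →
  h ≐ e ∗ k → h₁ ≐ e' ∗ g → h ≐ h₁ ∗ h₂ → k ≐ g ∗ h₂
∗-cancel-singletonˡ {a = a} sg sg' spk spg sp c with c ≟ a
... | yes refl =
  inj₁ ( trans (∗-disjoint spk (singleton-at sg)) (sym (∗-disjoint spg (singleton-at sg')))
       , ∗-disjoint sp (∗-definedˡ spg (singleton-at sg')))
... | no c≢a with ∗-undefinedˡ spk (singleton-outside sg c≢a)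
                | ∗-undefinedˡ spg (singleton-outside sg' c≢a) | sp c
...   | hk | hg | inj₁ (p , q) = inj₁ (trans (sym hk) (trans p hg) , q)
...   | hk | hg | inj₂ (p , q) = inj₂ (trans (sym hk) p , trans (sym hg) q)

∗-singleton-complement-empty :
  IsSingleton h a b → h ≐ h₁ ∗ h₂ → h₁ a ≡ just v → IsEmpty h₂
∗-singleton-complement-empty {a = a} sg sp eq c with c ≟ a
... | yes refl = ∗-disjoint sp eq
... | no c≢a with sp c
...   | inj₁ (_ , q) = q
...   | inj₂ (p , _) = trans (sym p) (singleton-outside sg c≢a)

Chain-resp-≗ : h ≗ h' → Chain h l → Chain h' l
Chain-resp-≗ {l = _ ∷ []}    h≗h' empty c = trans (sym (h≗h' c)) (empty c)
Chain-resp-≗ {l = _ ∷ _ ∷ _} h≗h' (k₁ , k₂ , sp , sg , ch) =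
  k₁ , k₂ , sp' , sg , ch
  where
  sp' : _ ≐ k₁ ∗ k₂
  sp' c with sp c
  ... | inj₁ (p , q) = inj₁ (trans (sym (h≗h' c)) p , q)
  ... | inj₂ (p , q) = inj₂ (trans (sym (h≗h' c)) p , q)

Chain-head : Chain h (a ∷ b ∷ l) → h a ≡ just b
Chain-head (_ , _ , sp , sg , _) = ∗-definedˡ sp (singleton-at sg)

singleton⇒Chain : IsSingleton h a b → Chain h (a ∷ b ∷ [])
singleton⇒Chain {h = h} sg = h , (λ _ → nothing) , (λ _ → inj₁ (refl , refl)) , sg , λ _ → refl

Segment : Heap → ℤ → ℤ → Set
Segment h a z = Σ (List ℤ) λ as → Head as a × Last as z × InitAvoid as z × Chain h as

Segment-defined-at-start : a ≢ z → Segment h a z → ∃ λ v → h a ≡ just v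
Segment-defined-at-start a≢z (_ , head , last-[] , _ , _)  = ⊥-elim (a≢z refl)
Segment-defined-at-start a≢z (_ , head , last-∷ _ , _ , ch) = _ , Chain-head ch

Segment-∖-prefix : h ≐ h₁ ∗ h₂ → Segment h a z →
  Chain h₁ (a ∷ l) → Last (a ∷ l) y → Segment h₂ y z
Segment-∖-prefix {l = []} sp (as , hd , lz , av , ch) empty last-[] =
  as , hd , lz , av , Chain-resp-≗ (∗-identityˡ empty sp) ch
Segment-∖-prefix {a = a} {l = _ ∷ _} sp (_ , head , last-[] , _ , empty) ch₁ _ =
  ⊥-elim (just≢nothing (trans (sym (∗-definedˡ sp (Chain-head ch₁))) (empty a)))
Segment-∖-prefix {l = b ∷ bs} sp
    (_ ∷ a₁ ∷ _ , head , last-∷ lz , (_ , av) , ch@(_ , _ , spk , sgk , chk))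
    ch₁@(_ , _ , spg , sgg , chg) (last-∷ ly) =
  Segment-∖-prefix (∗-cancel-singletonˡ sgk sgg spk spg sp) (_ , head , lz , av , chk)
    (subst (λ t → Chain _ (t ∷ bs)) b≡a₁ chg) (subst (λ t → Last (t ∷ bs) _) b≡a₁ ly)
  where
  b≡a₁ : b ≡ a₁
  b≡a₁ = just-injective (trans (sym (∗-definedˡ sp (Chain-head ch₁))) (Chain-head ch))

module _ {Stack : Set} (Expr : Set) (⟦_⟧ : Expr → Stack → ℤ) where
  open SL Expr ⟦_⟧

  update-sound : (S S' : Spatial) (s : Stack) → s ⊨ᵖ Collide S S' →
    (h : Heap) → s , h ⊨ S' →
    (h₁ h₂ : Heap) → h ≐ h₁ ∗ h₂ → s , h₁ ⊨ S →
    Σ Spatial λ U → Update S S' ≡ just U × s , h₂ ⊨ U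
  update-sound (next x y) (next x' z) s (_ , _ , x≡x') h hS' h₁ h₂ sp hS =
    emp , refl ,
    ∗-singleton-complement-empty hS' sp
      (subst (λ a → h₁ a ≡ just (⟦ y ⟧ s)) x≡x' (singleton-at hS))
  update-sound (next x y) (lseg x' z) s (_ , _ , x≡x') h hS' h₁ h₂ sp hS =
    lseg y z , refl ,
    Segment-∖-prefix sp hS'
      (subst (λ a → Chain h₁ (a ∷ ⟦ y ⟧ s ∷ [])) x≡x' (singleton⇒Chain hS)) (last-∷ last-[])
  update-sound (lseg x y) (next x' z) s (x≢y , _ , x≡x') h hS' h₁ h₂ sp hS =
    emp , refl ,
    ∗-singleton-complement-empty hS' sp
      (proj₂ (subst (λ a → ∃ λ v → h₁ a ≡ just v) x≡x' (Segment-defined-at-start x≢y hS)))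
  update-sound (lseg x y) (lseg x' z) s (_ , _ , x≡x') h hS' h₁ h₂ sp
      (_ , head {as = bs} , ly , _ , ch) =
    lseg y z , refl ,
    Segment-∖-prefix sp hS'
      (subst (λ a → Chain h₁ (a ∷ bs)) x≡x' ch)
      (subst (λ a → Last (a ∷ bs) (⟦ y ⟧ s)) x≡x' ly)

proposition1 : {Stack : Set} (Expr : Set) (⟦_⟧ : Expr → Stack → ℤ) →
    let open SL Expr ⟦_⟧ in
    (S S' : Spatial) (s : Stack) → s ⊨ᵖ Collide S S' →
    (h : Heap) → s , h ⊨ S' →
    (h₁ h₂ : Heap) → h ≐ h₁ ∗ h₂ → s , h₁ ⊨ S →
    Σ Spatial λ U → Update S S' ≡ just U × s , h₂ ⊨ U
proposition1 = update-sound
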